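{- Let $n>2$ be an integer (odd or even) and let $q\in\mathcal{B}_n$ with $wt(q)=w\le 2^{n-1}$. Then for every balanced $f\in\mathcal{B}_n$ and every $A\in GL_n$, $$|W_q(f)(A)|\in\{0,4,8,\ldots,2w-4,2w\}\quad\text{if } w \text{ is even},$$ and $$|W_q(f)(A)|\in\{2,6,10,\ldots,2w-4,2w\}\quad\text{if } w \text{ is odd}.$$
   Context: $V_n=\{0,1\}^n$ (row vectors) and $\mathcal{B}_n$ is the set of Boolean functions $V_n\to\{0,1\}$. $wt(f)=|\{a\in V_n: f(a)=1\}|$; $f$ is balanced if $wt(f)=2^{n-1}$. For $f,g\in\mathcal{B}_n$, $W(f,g)=\sum_{a\in V_n}(-1)^{f(a)+g(a)}$. $GL_n$ is the group of invertible $n\times n$ matrices over $\mathbb{F}_2$. For $q\in\mathcal{B}_n$ and $A\in GL_n$, $q_A(a)=q(aA)$, and the $q$-transform coefficient of $f$ at $A$ is $W_q(f)(A)=W(f,q_A)$. -}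

module Defs where

open import Data.Bool using (Bool; true; false; _∧_; _xor_; if_then_else_)
open import Data.Nat using (ℕ; zero; suc)
open import Data.Integer using (ℤ; +_; -[1+_]; _+_)
open import Data.List using (List; []; _∷_; map; _++_; foldr)
open import Data.Vec using (Vec; []; _∷_; tabulate; lookup)
open import Data.Fin using (Fin)
open import Data.Fin.Properties using () renaming (_≟_ to _≟F_)
open import Data.Product using (Σ; _×_)
open import Relation.Binary.PropositionalEquality using (_≡_)
open import Relation.Nullary.Decidable using (does)

-- V_n = {0,1}^n as row vectors over F_2 (false = 0, true = 1)
V : ℕ → Set
V n = Vec Bool n

BoolFun : ℕ → Set
BoolFun n = V n → Bool

allV : (n : ℕ) → List (V n)
allV zero = [] ∷ []
allV (suc n) = map (false ∷_) (allV n) ++ map (true ∷_) (allV n)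

wt : {n : ℕ} → BoolFun n → ℕ
wt {n} f = foldr (λ a acc → if f a then suc acc else acc) 0 (allV n)

W : {n : ℕ} → BoolFun n → BoolFun n → ℤ
W {n} f g = foldr (λ a acc → (if f a xor g a then -[1+ 0 ] else + 1) + acc) (+ 0) (allV n)

-- n × n matrices over F_2, given by entries M i j (row i, column j)
Mat : ℕ → Set
Mat n = Fin n → Fin n → Bool

xorSum : {k : ℕ} → Vec Bool k → Bool
xorSum [] = false
xorSum (b ∷ bs) = b xor xorSum bs

_⊗_ : {n : ℕ} → Mat n → Mat n → Mat n
(M ⊗ N) i j = xorSum (tabulate (λ k → M i k ∧ N k j))

I : {n : ℕ} → Mat n
I i j = does (i ≟F j)

InGL : {n : ℕ} → Mat n → Set
InGL {n} A = Σ (Mat n) (λ B → ((A ⊗ B) ≡ I) × ((B ⊗ A) ≡ I))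

_·_ : {n : ℕ} → V n → Mat n → V n
a · A = tabulate (λ j → xorSum (tabulate (λ i → lookup a i ∧ A i j)))

_∘ₘ_ : {n : ℕ} → BoolFun n → Mat n → BoolFun n
(q ∘ₘ A) a = q (a · A)

Wq : {n : ℕ} → BoolFun n → BoolFun n → Mat n → ℤ
Wq q f A = W f (q ∘ₘ A)

-- Put g = q_A. Since a ↦ aA is a bijection of V_n, wt g = wt q = w. Split the support
-- of g into the k points where f = 1 and the r = w - k points where f = 0. Summing
-- (-1)^(x+y) = 1 - 2x - 2y + 4xy over V_n gives W(f,g) = 2^n - 2 wt f + 2k - 2r, which is
-- 2(k - r) for balanced f. Hence |W(f,g)| = 2|k - r| with |k - r| ≤ k + r = w and
-- |k - r| ≡ w (mod 2).
module Submission where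

open import Defs
open import Data.Nat using (ℕ; _+_; _*_; _^_; _∸_; _≤_; _<_; _%_)
open import Data.Integer using (∣_∣)
open import Data.Product using (Σ; _×_)
open import Relation.Binary.PropositionalEquality using (_≡_)

open import Algebra.Bundles using (CommutativeRing; CommutativeMonoid)
open import Data.Bool using (Bool; true; false; not; _∧_; _xor_; if_then_else_)
open import Data.Bool.Properties
  using (∧-assoc; ∧-zeroʳ; ∧-identityʳ; ∧-distribˡ-xor; ∧-distribʳ-xor; xor-identityʳ; xor-∧-commutativeRing)
  renaming (_≟_ to _≟B_)
open import Data.Fin using (Fin; zero; suc)
import Data.Integer as ℤ
open import Data.Integer using (_⊖_) renaming (_+_ to _+ℤ_)
import Data.Integer.Properties as ℤ
open import Data.List using (List; []; _∷_; map; _++_; foldr)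
open import Data.Nat using (zero; suc; _⊓_; ∣_-_∣)
open import Data.Nat.DivMod using (_/_; m≡m%n+[m/n]*n; [m+kn]%n≡m%n)
open import Data.Nat.Properties
open import Data.Nat.Tactic.RingSolver using (solve-∀)
open import Data.Product using (_,_)
open import Data.Sum using (inj₁; inj₂)
open import Data.Vec using ([]; _∷_; tabulate; lookup)
open import Data.Vec.Properties using (tabulate-cong; lookup∘tabulate; tabulate∘lookup; ≡-dec)
open import Function using (_∘_; mk⇔)
open import Relation.Binary.Definitions using (DecidableEquality)
open import Relation.Binary.PropositionalEquality
  using (refl; sym; trans; cong; cong₂; subst; subst₂; module ≡-Reasoning)
open import Relation.Nullary.Decidable using (does; does-⇔; yes; no)
open import Algebra.Properties.CommutativeSemigroup
  (CommutativeMonoid.commutativeSemigroup (CommutativeRing.+-commutativeMonoid xor-∧-commutativeRing))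
  using (interchange)

Σ₂ : ∀ {m} → (Fin m → Bool) → Bool
Σ₂ f = xorSum (tabulate f)

Σ₂-cong : ∀ {m} {f g : Fin m → Bool} → (∀ i → f i ≡ g i) → Σ₂ f ≡ Σ₂ g
Σ₂-cong f≗g = cong xorSum (tabulate-cong f≗g)

Σ₂-false : ∀ m → Σ₂ {m} (λ _ → false) ≡ false
Σ₂-false zero = refl
Σ₂-false (suc m) = Σ₂-false m

Σ₂-∧-distribʳ : ∀ {m} b (f : Fin m → Bool) → Σ₂ f ∧ b ≡ Σ₂ (λ i → f i ∧ b)
Σ₂-∧-distribʳ {zero} b f = refl
Σ₂-∧-distribʳ {suc m} b f =
  trans (∧-distribʳ-xor b (f zero) (Σ₂ (f ∘ suc))) (cong ((f zero ∧ b) xor_) (Σ₂-∧-distribʳ b (f ∘ suc)))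

Σ₂-∧-distribˡ : ∀ {m} b (f : Fin m → Bool) → b ∧ Σ₂ f ≡ Σ₂ (λ i → b ∧ f i)
Σ₂-∧-distribˡ {zero} b f = ∧-zeroʳ b
Σ₂-∧-distribˡ {suc m} b f =
  trans (∧-distribˡ-xor b (f zero) (Σ₂ (f ∘ suc))) (cong ((b ∧ f zero) xor_) (Σ₂-∧-distribˡ b (f ∘ suc)))

Σ₂-xor : ∀ {m} (f g : Fin m → Bool) → Σ₂ (λ i → f i xor g i) ≡ Σ₂ f xor Σ₂ g
Σ₂-xor {zero} f g = refl
Σ₂-xor {suc m} f g =
  trans (cong ((f zero xor g zero) xor_) (Σ₂-xor (f ∘ suc) (g ∘ suc)))
        (interchange (f zero) (g zero) (Σ₂ (f ∘ suc)) (Σ₂ (g ∘ suc)))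

Σ₂-comm : ∀ {m k} (G : Fin m → Fin k → Bool) → Σ₂ (λ i → Σ₂ (G i)) ≡ Σ₂ (λ j → Σ₂ (λ i → G i j))
Σ₂-comm {zero} {k} G = sym (Σ₂-false k)
Σ₂-comm {suc m} G =
  trans (cong (Σ₂ (G zero) xor_) (Σ₂-comm (G ∘ suc))) (sym (Σ₂-xor (G zero) (λ j → Σ₂ (λ i → G (suc i) j))))

Σ₂-identity : ∀ {m} (f : Fin m → Bool) j → Σ₂ (λ i → f i ∧ I i j) ≡ f j
Σ₂-identity {suc m} f zero = begin
    (f zero ∧ true) xor Σ₂ (λ i → f (suc i) ∧ false)
  ≡⟨ cong₂ _xor_ (∧-identityʳ (f zero)) (Σ₂-cong {m} (∧-zeroʳ ∘ f ∘ suc)) ⟩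
    f zero xor Σ₂ {m} (λ _ → false)
  ≡⟨ cong (f zero xor_) (Σ₂-false m) ⟩
    f zero xor false
  ≡⟨ xor-identityʳ (f zero) ⟩
    f zero
  ∎
  where open ≡-Reasoning
Σ₂-identity {suc m} f (suc j) =
  trans (cong (_xor Σ₂ (λ i → f (suc i) ∧ I i j)) (∧-zeroʳ (f zero))) (Σ₂-identity (f ∘ suc) j)

·-⊗-assoc : ∀ {n} (a : V n) (A B : Mat n) → (a · A) · B ≡ a · (A ⊗ B)
·-⊗-assoc a A B = tabulate-cong λ j → begin
    Σ₂ (λ i → lookup (a · A) i ∧ B i j)
  ≡⟨ Σ₂-cong (λ i → cong (_∧ B i j) (lookup∘tabulate _ i)) ⟩
    Σ₂ (λ i → Σ₂ (λ k → lookup a k ∧ A k i) ∧ B i j)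
  ≡⟨ Σ₂-cong (λ i → Σ₂-∧-distribʳ (B i j) (λ k → lookup a k ∧ A k i)) ⟩
    Σ₂ (λ i → Σ₂ (λ k → (lookup a k ∧ A k i) ∧ B i j))
  ≡⟨ Σ₂-comm (λ i k → (lookup a k ∧ A k i) ∧ B i j) ⟩
    Σ₂ (λ k → Σ₂ (λ i → (lookup a k ∧ A k i) ∧ B i j))
  ≡⟨ Σ₂-cong (λ k → Σ₂-cong (λ i → ∧-assoc (lookup a k) (A k i) (B i j))) ⟩
    Σ₂ (λ k → Σ₂ (λ i → lookup a k ∧ (A k i ∧ B i j)))
  ≡⟨ Σ₂-cong (λ k → sym (Σ₂-∧-distribˡ (lookup a k) (λ i → A k i ∧ B i j))) ⟩
    Σ₂ (λ k → lookup a k ∧ Σ₂ (λ i → A k i ∧ B i j))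
  ∎
  where open ≡-Reasoning

·-identityʳ : ∀ {n} (a : V n) → a · I ≡ a
·-identityʳ a = trans (tabulate-cong (Σ₂-identity (lookup a))) (tabulate∘lookup a)

·-inverseʳ : ∀ {n} {A B : Mat n} → A ⊗ B ≡ I → ∀ a → (a · A) · B ≡ a
·-inverseʳ {A = A} {B} A⊗B≡I a = trans (·-⊗-assoc a A B) (trans (cong (a ·_) A⊗B≡I) (·-identityʳ a))

sumBy : ∀ {A : Set} → (A → ℕ) → List A → ℕ
sumBy h [] = 0
sumBy h (x ∷ xs) = h x + sumBy h xs

module _ {A : Set} where

  sumBy-cong : ∀ {f g : A → ℕ} → (∀ x → f x ≡ g x) → ∀ xs → sumBy f xs ≡ sumBy g xs
  sumBy-cong f≗g [] = refl
  sumBy-cong f≗g (x ∷ xs) = cong₂ _+_ (f≗g x) (sumBy-cong f≗g xs)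

  sumBy-++ : ∀ (h : A → ℕ) xs ys → sumBy h (xs ++ ys) ≡ sumBy h xs + sumBy h ys
  sumBy-++ h [] ys = refl
  sumBy-++ h (x ∷ xs) ys = trans (cong (h x +_) (sumBy-++ h xs ys)) (sym (+-assoc (h x) _ _))

  sumBy-zero : ∀ (xs : List A) → sumBy (λ _ → 0) xs ≡ 0
  sumBy-zero [] = refl
  sumBy-zero (x ∷ xs) = sumBy-zero xs

  sumBy-+ : ∀ (f g : A → ℕ) xs → sumBy (λ x → f x + g x) xs ≡ sumBy f xs + sumBy g xs
  sumBy-+ f g [] = refl
  sumBy-+ f g (x ∷ xs) =
    trans (cong (f x + g x +_) (sumBy-+ f g xs)) (+-interchange (f x) (g x) (sumBy f xs) (sumBy g xs))
    where
    +-interchange : ∀ a b c d → (a + b) + (c + d) ≡ (a + c) + (b + d)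
    +-interchange = solve-∀

  sumBy-*ʳ : ∀ (f : A → ℕ) k xs → sumBy (λ x → f x * k) xs ≡ sumBy f xs * k
  sumBy-*ʳ f k [] = refl
  sumBy-*ʳ f k (x ∷ xs) = trans (cong (f x * k +_) (sumBy-*ʳ f k xs)) (sym (*-distribʳ-+ k (f x) (sumBy f xs)))

sumBy-map : ∀ {A B : Set} (h : B → ℕ) (g : A → B) xs → sumBy h (map g xs) ≡ sumBy (h ∘ g) xs
sumBy-map h g [] = refl
sumBy-map h g (x ∷ xs) = cong (h (g x) +_) (sumBy-map h g xs)

sumBy-comm : ∀ {A B : Set} (G : A → B → ℕ) xs ys →
  sumBy (λ x → sumBy (G x) ys) xs ≡ sumBy (λ y → sumBy (λ x → G x y) xs) ys
sumBy-comm G [] ys = sym (sumBy-zero ys)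
sumBy-comm G (x ∷ xs) ys =
  trans (cong (sumBy (G x) ys +_) (sumBy-comm G xs ys)) (sym (sumBy-+ (G x) (λ y → sumBy (λ x → G x y) xs) ys))

∑ : ∀ {n} → (V n → ℕ) → ℕ
∑ {n} h = sumBy h (allV n)

∑-split : ∀ {n} (h : V (suc n) → ℕ) → ∑ h ≡ ∑ (h ∘ (false ∷_)) + ∑ (h ∘ (true ∷_))
∑-split {n} h =
  trans (sumBy-++ h (map (false ∷_) (allV n)) (map (true ∷_) (allV n)))
        (cong₂ _+_ (sumBy-map h (false ∷_) (allV n)) (sumBy-map h (true ∷_) (allV n)))

∑-one : ∀ n → ∑ {n} (λ _ → 1) ≡ 2 ^ n
∑-one zero = refl
∑-one (suc n) =
  trans (∑-split {n} (λ _ → 1)) (trans (cong₂ _+_ (∑-one n) (∑-one n)) (cong (2 ^ n +_) (sym (+-identityʳ (2 ^ n)))))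

χ : Bool → ℕ
χ b = if b then 1 else 0

_≟V_ : ∀ {n} → DecidableEquality (V n)
_≟V_ = ≡-dec _≟B_

δ : ∀ {n} → V n → V n → ℕ
δ x c = χ (does (x ≟V c))

∑-δ : ∀ n (c : V n) → ∑ (λ x → δ x c) ≡ 1
∑-δ zero [] = refl
∑-δ (suc n) (false ∷ c) = trans (∑-split (λ x → δ x (false ∷ c))) (cong₂ _+_ (∑-δ n c) (sumBy-zero (allV n)))
∑-δ (suc n) (true ∷ c) = trans (∑-split (λ x → δ x (true ∷ c))) (cong₂ _+_ (sumBy-zero (allV n)) (∑-δ n c))

∑-δ-sift : ∀ {n} (h : V n → ℕ) c → ∑ (λ x → δ x c * h x) ≡ h c
∑-δ-sift {n} h c = begin
    ∑ (λ x → δ x c * h x)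
  ≡⟨ sumBy-cong δ*h≗δ*hc (allV n) ⟩
    ∑ (λ x → δ x c * h c)
  ≡⟨ sumBy-*ʳ (λ x → δ x c) (h c) (allV n) ⟩
    ∑ (λ x → δ x c) * h c
  ≡⟨ cong (_* h c) (∑-δ n c) ⟩
    1 * h c
  ≡⟨ *-identityˡ (h c) ⟩
    h c
  ∎
  where
  open ≡-Reasoning
  δ*h≗δ*hc : ∀ x → δ x c * h x ≡ δ x c * h c
  δ*h≗δ*hc x with x ≟V c
  ... | yes refl = refl
  ... | no _ = refl

∑-∘-bijection : ∀ {n} {σ τ : V n → V n} → (∀ a → τ (σ a) ≡ a) → (∀ b → σ (τ b) ≡ b) →
  (h : V n → ℕ) → ∑ (h ∘ σ) ≡ ∑ h
∑-∘-bijection {n} {σ} {τ} τσ≗id στ≗id h = begin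
    ∑ (λ a → h (σ a))
  ≡⟨ sumBy-cong (λ a → sym (∑-δ-sift h (σ a))) (allV n) ⟩
    ∑ (λ a → ∑ (λ b → δ b (σ a) * h b))
  ≡⟨ sumBy-comm (λ a b → δ b (σ a) * h b) (allV n) (allV n) ⟩
    ∑ (λ b → ∑ (λ a → δ b (σ a) * h b))
  ≡⟨ sumBy-cong (λ b → sumBy-cong (λ a → cong (λ t → χ t * h b) (b≡σa⇔a≡τb a b)) (allV n)) (allV n) ⟩
    ∑ (λ b → ∑ (λ a → δ a (τ b) * h b))
  ≡⟨ sumBy-cong (λ b → sumBy-*ʳ (λ a → δ a (τ b)) (h b) (allV n)) (allV n) ⟩
    ∑ (λ b → ∑ (λ a → δ a (τ b)) * h b)
  ≡⟨ sumBy-cong (λ b → trans (cong (_* h b) (∑-δ n (τ b))) (*-identityˡ (h b))) (allV n) ⟩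
    ∑ h
  ∎
  where
  open ≡-Reasoning
  b≡σa⇔a≡τb : ∀ a b → does (b ≟V σ a) ≡ does (a ≟V τ b)
  b≡σa⇔a≡τb a b = does-⇔
    (mk⇔ (λ b≡σa → trans (sym (τσ≗id a)) (cong τ (sym b≡σa)))
         (λ a≡τb → trans (sym (στ≗id b)) (cong σ (sym a≡τb))))
    (b ≟V σ a) (a ≟V τ b)

count≡sumBy-χ : ∀ {A : Set} (p : A → Bool) xs →
  foldr (λ a acc → if p a then suc acc else acc) 0 xs ≡ sumBy (χ ∘ p) xs
count≡sumBy-χ p [] = refl
count≡sumBy-χ p (x ∷ xs) with p x
... | true = cong suc (count≡sumBy-χ p xs)
... | false = count≡sumBy-χ p xs

wt≡∑χ : ∀ {n} (f : BoolFun n) → wt f ≡ ∑ (χ ∘ f)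
wt≡∑χ {n} f = count≡sumBy-χ f (allV n)

wt-∘ₘ : ∀ {n} (q : BoolFun n) {A : Mat n} → InGL A → wt (q ∘ₘ A) ≡ wt q
wt-∘ₘ q {A} (B , A⊗B≡I , B⊗A≡I) = begin
    wt (q ∘ₘ A)
  ≡⟨ wt≡∑χ (q ∘ₘ A) ⟩
    ∑ (χ ∘ q ∘ (_· A))
  ≡⟨ ∑-∘-bijection {σ = _· A} {τ = _· B} (·-inverseʳ A⊗B≡I) (·-inverseʳ B⊗A≡I) (χ ∘ q) ⟩
    ∑ (χ ∘ q)
  ≡⟨ wt≡∑χ q ⟨
    wt q
  ∎
  where open ≡-Reasoning

wt-split : ∀ {n} (f g : BoolFun n) → wt g ≡ wt (λ a → f a ∧ g a) + wt (λ a → not (f a) ∧ g a)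
wt-split {n} f g = begin
    wt g
  ≡⟨ wt≡∑χ g ⟩
    ∑ (χ ∘ g)
  ≡⟨ sumBy-cong (λ a → χ-split (f a) (g a)) (allV n) ⟩
    ∑ (λ a → χ (f a ∧ g a) + χ (not (f a) ∧ g a))
  ≡⟨ sumBy-+ (λ a → χ (f a ∧ g a)) (λ a → χ (not (f a) ∧ g a)) (allV n) ⟩
    ∑ (λ a → χ (f a ∧ g a)) + ∑ (λ a → χ (not (f a) ∧ g a))
  ≡⟨ cong₂ _+_ (wt≡∑χ (λ a → f a ∧ g a)) (wt≡∑χ (λ a → not (f a) ∧ g a)) ⟨
    wt (λ a → f a ∧ g a) + wt (λ a → not (f a) ∧ g a)
  ∎
  where
  open ≡-Reasoning
  χ-split : ∀ x y → χ y ≡ χ (x ∧ y) + χ (not x ∧ y)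
  χ-split false y = refl
  χ-split true y = sym (+-identityʳ (χ y))

agreements disagreements : ∀ {n} → BoolFun n → BoolFun n → ℕ
agreements f g = ∑ (λ a → χ (not (f a xor g a)))
disagreements f g = ∑ (λ a → χ (f a xor g a))

signSum≡count⊖count : ∀ {A : Set} (p : A → Bool) xs →
  foldr (λ a acc → (if p a then ℤ.-1ℤ else ℤ.1ℤ) +ℤ acc) ℤ.0ℤ xs
    ≡ sumBy (χ ∘ not ∘ p) xs ⊖ sumBy (χ ∘ p) xs
signSum≡count⊖count p [] = refl
signSum≡count⊖count p (x ∷ xs) with p x
... | true = trans (cong (ℤ.-1ℤ +ℤ_) (signSum≡count⊖count p xs))
                   (ℤ.distribʳ-⊖-+-neg 0 (sumBy (χ ∘ not ∘ p) xs) (sumBy (χ ∘ p) xs))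
... | false = trans (cong (ℤ.1ℤ +ℤ_) (signSum≡count⊖count p xs))
                    (ℤ.distribʳ-⊖-+-pos 1 (sumBy (χ ∘ not ∘ p) xs) (sumBy (χ ∘ p) xs))

W≡agreements⊖disagreements : ∀ {n} (f g : BoolFun n) → W f g ≡ agreements f g ⊖ disagreements f g
W≡agreements⊖disagreements {n} f g = signSum≡count⊖count (λ a → f a xor g a) (allV n)

∑-linear : ∀ {n} (u v w : V n → ℕ) → ∑ (λ a → u a + v a * 2 + w a) ≡ ∑ u + ∑ v * 2 + ∑ w
∑-linear {n} u v w =
  trans (sumBy-+ (λ a → u a + v a * 2) w (allV n))
        (cong (_+ ∑ w) (trans (sumBy-+ u (λ a → v a * 2) (allV n)) (cong (∑ u +_) (sumBy-*ʳ v 2 (allV n)))))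

agreements+2wt[¬f∧g]≡disagreements+2wt[f∧g] : ∀ m (f g : BoolFun (suc m)) → wt f ≡ 2 ^ m →
  agreements f g + wt (λ a → not (f a) ∧ g a) * 2 ≡ disagreements f g + wt (λ a → f a ∧ g a) * 2
agreements+2wt[¬f∧g]≡disagreements+2wt[f∧g] m f g wt-f = +-cancelʳ-≡ (2 ^ suc m) _ _ (begin
    agreements f g + r * 2 + 2 ^ suc m
  ≡⟨ cong (agreements f g + r * 2 +_) (trans (*-comm 2 (2 ^ m)) (cong (_* 2) (sym wt-f))) ⟩
    agreements f g + r * 2 + wt f * 2
  ≡⟨ cong₂ (λ s t → agreements f g + s * 2 + t * 2) (wt≡∑χ (λ a → not (f a) ∧ g a)) (wt≡∑χ f) ⟩
    agreements f g + ∑ (λ a → χ (not (f a) ∧ g a)) * 2 + ∑ (χ ∘ f) * 2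
  ≡⟨ cong (agreements f g + ∑ (λ a → χ (not (f a) ∧ g a)) * 2 +_) (sym (sumBy-*ʳ (χ ∘ f) 2 (allV (suc m)))) ⟩
    agreements f g + ∑ (λ a → χ (not (f a) ∧ g a)) * 2 + ∑ (λ a → χ (f a) * 2)
  ≡⟨ ∑-linear (λ a → χ (not (f a xor g a))) (λ a → χ (not (f a) ∧ g a)) (λ a → χ (f a) * 2) ⟨
    ∑ (λ a → χ (not (f a xor g a)) + χ (not (f a) ∧ g a) * 2 + χ (f a) * 2)
  ≡⟨ sumBy-cong (λ a → sign-expansion (f a) (g a)) (allV (suc m)) ⟩
    ∑ (λ a → χ (f a xor g a) + χ (f a ∧ g a) * 2 + 1)
  ≡⟨ ∑-linear {suc m} (λ a → χ (f a xor g a)) (λ a → χ (f a ∧ g a)) (λ _ → 1) ⟩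
    disagreements f g + ∑ (λ a → χ (f a ∧ g a)) * 2 + ∑ {suc m} (λ _ → 1)
  ≡⟨ cong₂ (λ s t → disagreements f g + s * 2 + t) (wt≡∑χ (λ a → f a ∧ g a)) (sym (∑-one (suc m))) ⟨
    disagreements f g + k * 2 + 2 ^ suc m
  ∎)
  where
  open ≡-Reasoning
  k r : ℕ
  k = wt (λ a → f a ∧ g a)
  r = wt (λ a → not (f a) ∧ g a)
  -- (-1)^(x+y) = 1 - 2x - 2y + 4xy with y = x∧y + ¬x∧y, rearranged so that no subtraction occurs.
  sign-expansion : ∀ x y → χ (not (x xor y)) + χ (not x ∧ y) * 2 + χ x * 2 ≡ χ (x xor y) + χ (x ∧ y) * 2 + 1
  sign-expansion false false = refl
  sign-expansion false true = refl
  sign-expansion true false = refl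
  sign-expansion true true = refl

∣m⊖n∣≡∣m-n∣ : ∀ m n → ∣ m ⊖ n ∣ ≡ ∣ m - n ∣
∣m⊖n∣≡∣m-n∣ m n with ≤-total m n
... | inj₁ m≤n = trans (ℤ.∣⊖∣-≤ m≤n) (sym (m≤n⇒∣m-n∣≡n∸m m≤n))
... | inj₂ n≤m = begin
    ∣ m ⊖ n ∣ ≡⟨ ℤ.∣m⊖n∣≡∣n⊖m∣ m n ⟩
    ∣ n ⊖ m ∣ ≡⟨ ℤ.∣⊖∣-≤ n≤m ⟩
    m ∸ n     ≡⟨ m≤n⇒∣m-n∣≡n∸m n≤m ⟨
    ∣ n - m ∣ ≡⟨ ∣-∣-comm n m ⟩
    ∣ m - n ∣ ∎
  where open ≡-Reasoning

∣a⊖d∣≡∣k-r∣*2 : ∀ {a d} k r → a + r * 2 ≡ d + k * 2 → ∣ a ⊖ d ∣ ≡ ∣ k - r ∣ * 2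
∣a⊖d∣≡∣k-r∣*2 {a} {d} k r balance = begin
    ∣ a ⊖ d ∣                   ≡⟨ ∣m⊖n∣≡∣m-n∣ a d ⟩
    ∣ a - d ∣                   ≡⟨ ∣m+n-m+o∣≡∣n-o∣ (r * 2) a d ⟨
    ∣ r * 2 + a - r * 2 + d ∣   ≡⟨ cong₂ ∣_-_∣ (+-comm (r * 2) a) (+-comm (r * 2) d) ⟩
    ∣ a + r * 2 - d + r * 2 ∣   ≡⟨ cong (∣_- d + r * 2 ∣) balance ⟩
    ∣ d + k * 2 - d + r * 2 ∣   ≡⟨ ∣m+n-m+o∣≡∣n-o∣ d (k * 2) (r * 2) ⟩
    ∣ k * 2 - r * 2 ∣           ≡⟨ *-distribʳ-∣-∣ 2 k r ⟨
    ∣ k - r ∣ * 2               ∎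
  where open ≡-Reasoning

∣W∣-balanced : ∀ m (f g : BoolFun (suc m)) → wt f ≡ 2 ^ m →
  ∣ W f g ∣ ≡ ∣ wt (λ a → f a ∧ g a) - wt (λ a → not (f a) ∧ g a) ∣ * 2
∣W∣-balanced m f g wt-f =
  trans (cong ∣_∣ (W≡agreements⊖disagreements f g))
        (∣a⊖d∣≡∣k-r∣*2 (wt (λ a → f a ∧ g a)) (wt (λ a → not (f a) ∧ g a))
                       (agreements+2wt[¬f∧g]≡disagreements+2wt[f∧g] m f g wt-f))

∣m-n∣+[m⊓n]*2≡m+n : ∀ m n → ∣ m - n ∣ + (m ⊓ n) * 2 ≡ m + n
∣m-n∣+[m⊓n]*2≡m+n zero n = +-identityʳ n
∣m-n∣+[m⊓n]*2≡m+n (suc m) zero = refl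
∣m-n∣+[m⊓n]*2≡m+n (suc m) (suc n) = begin
    ∣ m - n ∣ + suc (suc ((m ⊓ n) * 2)) ≡⟨ +-suc ∣ m - n ∣ (suc ((m ⊓ n) * 2)) ⟩
    suc (∣ m - n ∣ + suc ((m ⊓ n) * 2)) ≡⟨ cong suc (+-suc ∣ m - n ∣ ((m ⊓ n) * 2)) ⟩
    suc (suc (∣ m - n ∣ + (m ⊓ n) * 2)) ≡⟨ cong (λ t → suc (suc t)) (∣m-n∣+[m⊓n]*2≡m+n m n) ⟩
    suc (suc (m + n))                   ≡⟨ cong suc (+-suc m n) ⟨
    suc (m + suc n)                     ∎
  where open ≡-Reasoning

twice-distance-values : ∀ {D w} k r → D ≡ ∣ k - r ∣ * 2 → w ≡ k + r →
  (w % 2 ≡ 0 → Σ ℕ (λ j → (D ≡ 4 * j) × (D ≤ 2 * w)))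
  × (w % 2 ≡ 1 → Σ ℕ (λ j → (D ≡ 4 * j + 2) × (D ≤ 2 * w)))
twice-distance-values {D} {w} k r D≡2d w≡k+r =
    (λ w%2≡0 → j , trans D≡[w%2+2j]*2 (trans (cong (λ b → (b + j * 2) * 2) w%2≡0) (even-shape j)) , D≤2w)
  , (λ w%2≡1 → j , trans D≡[w%2+2j]*2 (trans (cong (λ b → (b + j * 2) * 2) w%2≡1) (odd-shape j)) , D≤2w)
  where
  d j : ℕ
  d = ∣ k - r ∣
  j = d / 2
  d+[k⊓r]*2≡w : d + (k ⊓ r) * 2 ≡ w
  d+[k⊓r]*2≡w = trans (∣m-n∣+[m⊓n]*2≡m+n k r) (sym w≡k+r)
  d%2≡w%2 : d % 2 ≡ w % 2
  d%2≡w%2 = trans (sym ([m+kn]%n≡m%n d (k ⊓ r) 2)) (cong (_% 2) d+[k⊓r]*2≡w)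
  D≡[w%2+2j]*2 : D ≡ (w % 2 + j * 2) * 2
  D≡[w%2+2j]*2 = trans D≡2d (cong (_* 2) (trans (m≡m%n+[m/n]*n d 2) (cong (_+ j * 2) d%2≡w%2)))
  D≤2w : D ≤ 2 * w
  D≤2w = subst₂ _≤_ (sym D≡2d) (*-comm w 2) (*-monoˡ-≤ 2 (subst (d ≤_) d+[k⊓r]*2≡w (m≤m+n d _)))
  even-shape : ∀ j → (0 + j * 2) * 2 ≡ 4 * j
  even-shape = solve-∀
  odd-shape : ∀ j → (1 + j * 2) * 2 ≡ 4 * j + 2
  odd-shape = solve-∀

lemma1 : (n : ℕ) → 2 < n → (q : BoolFun n) → wt q ≤ 2 ^ (n ∸ 1) →
    (f : BoolFun n) → wt f ≡ 2 ^ (n ∸ 1) → (A : Mat n) → InGL A →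
    ((wt q % 2 ≡ 0 →
        Σ ℕ (λ j → (∣ Wq q f A ∣ ≡ 4 * j) × (∣ Wq q f A ∣ ≤ 2 * wt q)))
    × (wt q % 2 ≡ 1 →
        Σ ℕ (λ j → (∣ Wq q f A ∣ ≡ 4 * j + 2) × (∣ Wq q f A ∣ ≤ 2 * wt q))))
lemma1 (suc m) _ q _ f f-balanced A A∈GL =
  twice-distance-values
    (wt (λ a → f a ∧ (q ∘ₘ A) a))
    (wt (λ a → not (f a) ∧ (q ∘ₘ A) a))
    (∣W∣-balanced m f (q ∘ₘ A) f-balanced)
    (trans (sym (wt-∘ₘ q {A} A∈GL)) (wt-split f (q ∘ₘ A)))
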